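{- Let $G$ be a König--Egerváry graph and let $\Omega(G)$ be the family of maximum independent sets of $G$. Then for every non-empty $\Gamma\subseteq\Omega(G)$, \[ \Big|\bigcup\Gamma\Big|+\Big|\bigcap\Gamma\Big|=2\alpha(G), \] where $\bigcup\Gamma$ and $\bigcap\Gamma$ denote the union and intersection of all sets in $\Gamma$.
   Context: All graphs are finite, simple and undirected. $\alpha(G)$ is the maximum size of an independent set and $\mu(G)$ the maximum size of a matching of $G$; $G$ is a König--Egerváry graph if $\alpha(G)+\mu(G)=|V(G)|$. -}

module Defs where

open import Data.Nat using (ℕ; _≤_)
open import Data.Fin using (Fin)
open import Data.Fin.Subset using (Subset; _∈_; ∣_∣)
open import Data.List using (List; length)
open import Data.List.Relation.Unary.AllPairs using (AllPairs)
open import Data.List.Relation.Unary.All using (All)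
open import Data.Product using (Σ; _×_; ∃; _,_; proj₁; proj₂)
open import Relation.Nullary using (¬_)
open import Relation.Binary.PropositionalEquality using (_≡_; _≢_)

record Graph (n : ℕ) : Set₁ where
  field
    Adj     : Fin n → Fin n → Set
    sym     : ∀ {i j} → Adj i j → Adj j i
    irrefl  : ∀ {i} → ¬ Adj i i

open Graph public

Independent : ∀ {n} → Graph n → Subset n → Set
Independent G S = ∀ {i j} → i ∈ S → j ∈ S → ¬ Adj G i j

Edge : ∀ {n} → Graph n → Set
Edge {n} G = Σ (Fin n × Fin n) λ p → Adj G (proj₁ p) (proj₂ p)

Disjoint : ∀ {n} {G : Graph n} → Edge G → Edge G → Set
Disjoint ((a , b) , _) ((c , d) , _) = a ≢ c × a ≢ d × b ≢ c × b ≢ d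

Matching : ∀ {n} → Graph n → Set
Matching G = Σ (List (Edge G)) (AllPairs (Disjoint {G = G}))

IsAlpha : ∀ {n} → Graph n → ℕ → Set
IsAlpha G a = (∃ λ S → Independent G S × ∣ S ∣ ≡ a)
            × (∀ S → Independent G S → ∣ S ∣ ≤ a)

IsMu : ∀ {n} → Graph n → ℕ → Set
IsMu G m = (∃ λ (M : Matching G) → length (proj₁ M) ≡ m)
         × (∀ (M : Matching G) → length (proj₁ M) ≤ m)

KönigEgerváry : ∀ {n} → Graph n → Set
KönigEgerváry {n} G = ∀ a m → IsAlpha G a → IsMu G m → Data.Nat._+_ a m ≡ n

MaxIndependent : ∀ {n} → Graph n → Subset n → Set
MaxIndependent G S = Independent G S × (∀ T → Independent G T → ∣ T ∣ ≤ ∣ S ∣)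

-- Fix a maximum matching M and let c be the number of vertices it leaves uncovered, so
-- that n = 2|M| + c and, G being König–Egerváry, α = |M| + c. An independent set meets
-- each edge of M at most once, so one of size α contains exactly one endpoint of every
-- edge of M and every uncovered vertex. Hence for each edge xy of M we have x ∈ ⋃Γ iff
-- y ∉ ⋂Γ and y ∈ ⋃Γ iff x ∉ ⋂Γ, so the edge contributes exactly 2 to |⋃Γ| + |⋂Γ|; so does
-- each uncovered vertex, and the total is 2|M| + 2c = 2α.
-- Adjacency is not decidable, so a maximum matching exists only up to double negation;
-- this suffices because the conclusion is a decidable equation.
module Submission where

open import Defs hiding (sym)
open import Data.Bool using (Bool; true; false; not; _∧_; _∨_; if_then_else_)
open import Data.Bool.ListAction using (any; all)
open import Data.Bool.Properties using (not-involutive)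
open import Data.Empty using (⊥-elim)
open import Data.Fin using (Fin; zero; suc)
open import Data.Fin.Properties using (_≟_)
open import Data.Fin.Subset using (Subset; ∣_∣; ⋃; ⋂)
open import Data.List as List using (List; []; _∷_; length)
open import Data.List.Relation.Unary.All as All using (All; []; _∷_)
open import Data.List.Relation.Unary.AllPairs using (AllPairs; []; _∷_)
open import Data.Nat using (ℕ; zero; suc; _+_; _*_; _≤_; z≤n)
open import Data.Nat.Properties
  using (≤-refl; ≤-reflexive; ≤-trans; ≤-antisym; ≤-pred; ≤∧≢⇒<; +-mono-≤; +-monoˡ-≤; +-monoʳ-≤;
         +-cancelˡ-≤; +-cancelʳ-≤; +-cancelʳ-≡; +-assoc; *-identityʳ; m≤m+n; m≤m*n;
         +-commutativeSemigroup; +-0-commutativeMonoid)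
  renaming (_≟_ to _≟ℕ_)
open import Data.Nat.Tactic.RingSolver using (solve-∀)
open import Data.Product using (∃; ∃-syntax; _×_; _,_; proj₁; proj₂)
open import Data.Vec using ([]; _∷_; lookup)
open import Data.Vec.Functional using (Vector)
open import Data.Vec.Properties using (lookup-zipWith; lookup-replicate; lookup⇒[]=)
open import Function using (_∘_)
open import Relation.Binary.PropositionalEquality
  using (_≡_; _≢_; refl; sym; trans; cong; cong₂; subst; module ≡-Reasoning)
open import Relation.Nullary using (¬_; yes; no; does)
open import Relation.Nullary.Decidable using (dec-false; decidable-stable; ¬¬-excluded-middle)

open import Algebra.Properties.CommutativeSemigroup +-commutativeSemigroup using (x∙yz≈y∙xz)
open import Algebra.Properties.CommutativeMonoid.Sum +-0-commutativeMonoid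
  using (sum; sum-cong-≗; ∑-distrib-+)

open ≡-Reasoning

𝟙 : Bool → ℕ
𝟙 true  = 1
𝟙 false = 0

𝟙≤1 : ∀ b → 𝟙 b ≤ 1
𝟙≤1 true  = ≤-refl
𝟙≤1 false = z≤n

𝟙≡1⇒≡true : ∀ {b} → 𝟙 b ≡ 1 → b ≡ true
𝟙≡1⇒≡true {true} _ = refl

𝟙+𝟙≡1⇒≡not : ∀ b c → 𝟙 b + 𝟙 c ≡ 1 → c ≡ not b
𝟙+𝟙≡1⇒≡not true  false _ = refl
𝟙+𝟙≡1⇒≡not false true  _ = refl

𝟙-complements : ∀ b c → (𝟙 b + 𝟙 c) + (𝟙 (not c) + 𝟙 (not b)) ≡ 2
𝟙-complements true  true  = refl
𝟙-complements true  false = refl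
𝟙-complements false true  = refl
𝟙-complements false false = refl

χ : ∀ {n} → Subset n → Vector ℕ n
χ p v = 𝟙 (lookup p v)

∣p∣≡∑χp : ∀ {n} (p : Subset n) → ∣ p ∣ ≡ sum (χ p)
∣p∣≡∑χp []          = refl
∣p∣≡∑χp (true  ∷ p) = cong suc (∣p∣≡∑χp p)
∣p∣≡∑χp (false ∷ p) = ∣p∣≡∑χp p

sum-const : ∀ n k → sum {n} (λ _ → k) ≡ n * k
sum-const zero    k = refl
sum-const (suc n) k = cong (k +_) (sum-const n k)

sum-mono-≤ : ∀ {n} {f g : Vector ℕ n} → (∀ i → f i ≤ g i) → sum f ≤ sum g
sum-mono-≤ {zero}  f≤g = z≤n
sum-mono-≤ {suc n} f≤g = +-mono-≤ (f≤g zero) (sum-mono-≤ (f≤g ∘ suc))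

+-tight : ∀ {a b c d} → a ≤ c → b ≤ d → c + d ≤ a + b → a ≡ c × b ≡ d
+-tight {a} {b} {c} {d} a≤c b≤d c+d≤a+b =
  ≤-antisym a≤c (+-cancelʳ-≤ d c a (≤-trans c+d≤a+b (+-monoʳ-≤ a b≤d))) ,
  ≤-antisym b≤d (+-cancelˡ-≤ a d b (≤-trans (+-monoˡ-≤ d a≤c) c+d≤a+b))

sum-tight : ∀ {n} {f g : Vector ℕ n} → (∀ i → f i ≤ g i) → sum g ≤ sum f → ∀ i → f i ≡ g i
sum-tight {suc n} f≤g ∑g≤∑f i with +-tight (f≤g zero) (sum-mono-≤ (f≤g ∘ suc)) ∑g≤∑f
sum-tight {suc n} f≤g ∑g≤∑f zero    | f₀≡g₀ , _   = f₀≡g₀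
sum-tight {suc n} f≤g ∑g≤∑f (suc i) | _ , ∑f≡∑g = sum-tight (f≤g ∘ suc) (≤-reflexive (sym ∑f≡∑g)) i

erase : ∀ {n} → Fin n → Vector ℕ n → Vector ℕ n
erase x g v = if does (v ≟ x) then 0 else g v

erase-≢ : ∀ {n} {x v : Fin n} (g : Vector ℕ n) → v ≢ x → erase x g v ≡ g v
erase-≢ {x = x} {v} g v≢x rewrite dec-false (v ≟ x) v≢x = refl

sum-erase : ∀ {n} (x : Fin n) (g : Vector ℕ n) → sum g ≡ g x + sum (erase x g)
sum-erase zero    g = refl
sum-erase (suc x) g = begin
  g zero + sum (g ∘ suc)                        ≡⟨ cong (g zero +_) (sum-erase x (g ∘ suc)) ⟩
  g zero + (g (suc x) + sum (erase x (g ∘ suc))) ≡⟨ x∙yz≈y∙xz (g zero) (g (suc x)) _ ⟩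
  g (suc x) + (g zero + sum (erase x (g ∘ suc))) ∎

any-complement : ∀ {A : Set} {p q : A → Bool} xs →
  All (λ x → q x ≡ not (p x)) xs → any q xs ≡ not (all p xs)
any-complement []       []           = refl
any-complement {p = p} (x ∷ xs) (qx≡ ∷ qxs≡) rewrite qx≡ | any-complement xs qxs≡ with p x
... | true  = refl
... | false = refl

all-complement : ∀ {A : Set} {p q : A → Bool} xs →
  All (λ x → q x ≡ not (p x)) xs → all q xs ≡ not (any p xs)
all-complement {p = p} {q} xs qxs≡ = begin
  all q xs             ≡⟨ sym (not-involutive _) ⟩
  not (not (all q xs)) ≡⟨ cong not (sym (any-complement xs (All.map flip qxs≡))) ⟩
  not (any p xs)       ∎
  where
  flip : ∀ {x} → q x ≡ not (p x) → p x ≡ not (q x)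
  flip {x} qx≡ = trans (sym (not-involutive (p x))) (cong not (sym qx≡))

all-true : ∀ {A : Set} {p : A → Bool} xs → All (λ x → p x ≡ true) xs → all p xs ≡ true
all-true []       []           = refl
all-true (x ∷ xs) (px≡ ∷ pxs≡) rewrite px≡ = all-true xs pxs≡

any-true : ∀ {A : Set} {p : A → Bool} {x xs} →
  All (λ x → p x ≡ true) (x ∷ xs) → any p (x ∷ xs) ≡ true
any-true (px≡ ∷ _) rewrite px≡ = refl

lookup-⋃ : ∀ {n} (L : List (Subset n)) v → lookup (⋃ L) v ≡ any (λ T → lookup T v) L
lookup-⋃ []      v = lookup-replicate v false
lookup-⋃ (T ∷ L) v = trans (lookup-zipWith _∨_ v T (⋃ L)) (cong (lookup T v ∨_) (lookup-⋃ L v))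

lookup-⋂ : ∀ {n} (L : List (Subset n)) v → lookup (⋂ L) v ≡ all (λ T → lookup T v) L
lookup-⋂ []      v = lookup-replicate v true
lookup-⋂ (T ∷ L) v = trans (lookup-zipWith _∧_ v T (⋂ L)) (cong (lookup T v ∧_) (lookup-⋂ L v))

m*2+n≡m+n+m : ∀ m n → m * 2 + n ≡ m + n + m
m*2+n≡m+n+m = solve-∀

m*2+[n+n]≡2*[m+n] : ∀ m n → m * 2 + (n + n) ≡ 2 * (m + n)
m*2+[n+n]≡2*[m+n] = solve-∀

¬¬-maximum : ∀ {P : ℕ → Set} B → P 0 → (∀ {j} → P j → j ≤ B) →
  ¬ ¬ (∃[ m ] (P m × ∀ {j} → P j → j ≤ m))
¬¬-maximum zero    p₀ bound k = k (0 , p₀ , bound)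
¬¬-maximum {P} (suc B) p₀ bound k = ¬¬-excluded-middle λ where
  (yes pB) → k (suc B , pB , bound)
  (no ¬pB) → ¬¬-maximum B p₀ (λ {j} pj → ≤-pred (≤∧≢⇒< (bound pj) (λ j≡ → ¬pB (subst P j≡ pj)))) k

module _ {n} (G : Graph n) where

  end₁ end₂ : Edge G → Fin n
  end₁ ((x , _) , _) = x
  end₂ ((_ , y) , _) = y

  endpointSum : Vector ℕ n → Edge G → ℕ
  endpointSum f e = f (end₁ e) + f (end₂ e)

  edgeSum : List (Edge G) → Vector ℕ n → ℕ
  edgeSum M f = sum (λ i → endpointSum f (List.lookup M i))

  covered : List (Edge G) → Fin n → Bool
  covered []      v = false
  covered (e ∷ M) v = does (v ≟ end₁ e) ∨ does (v ≟ end₂ e) ∨ covered M v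

  uncovered : List (Edge G) → Vector ℕ n → Vector ℕ n
  uncovered M f v = if covered M v then 0 else f v

  #uncovered : List (Edge G) → ℕ
  #uncovered M = sum (uncovered M (λ _ → 1))

  uncovered-at : ∀ M (f : Vector ℕ n) {v} → covered M v ≡ false → uncovered M f v ≡ f v
  uncovered-at M f cv rewrite cv = refl

  uncovered-mono-≤ : ∀ M {f g : Vector ℕ n} → (∀ v → f v ≤ g v) →
    ∀ v → uncovered M f v ≤ uncovered M g v
  uncovered-mono-≤ M f≤g v with covered M v
  ... | true  = z≤n
  ... | false = f≤g v

  endpoints-uncovered : ∀ {x y} (xy : Adj G x y) M → All (Disjoint {G = G} ((x , y) , xy)) M →
    covered M x ≡ false × covered M y ≡ false
  endpoints-uncovered xy [] [] = refl , refl
  endpoints-uncovered {x} {y} xy (((c , d) , _) ∷ M) ((x≢c , x≢d , y≢c , y≢d) ∷ disjoint)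
    rewrite dec-false (x ≟ c) x≢c | dec-false (x ≟ d) x≢d
          | dec-false (y ≟ c) y≢c | dec-false (y ≟ d) y≢d = endpoints-uncovered xy M disjoint

  erase-erase-uncovered : ∀ e M (f : Vector ℕ n) v →
    erase (end₂ e) (erase (end₁ e) (uncovered M f)) v ≡ uncovered (e ∷ M) f v
  erase-erase-uncovered e M f v with does (v ≟ end₁ e) | does (v ≟ end₂ e)
  ... | true  | true  = refl
  ... | true  | false = refl
  ... | false | true  = refl
  ... | false | false = refl

  sum-uncovered-∷ : ∀ {x y} (xy : Adj G x y) M → All (Disjoint {G = G} ((x , y) , xy)) M → ∀ f →
    let e = ((x , y) , xy) in sum (uncovered M f) ≡ endpointSum f e + sum (uncovered (e ∷ M) f)
  sum-uncovered-∷ {x} {y} xy M disjoint f = begin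
    sum g                                 ≡⟨ sum-erase x g ⟩
    g x + sum (erase x g)                 ≡⟨ cong (g x +_) (sum-erase y (erase x g)) ⟩
    g x + (erase x g y + sum g∖xy)        ≡⟨ cong₂ (λ a b → a + (b + sum g∖xy)) gx≡fx gy≡fy ⟩
    f x + (f y + sum g∖xy)                ≡⟨ sym (+-assoc (f x) (f y) _) ⟩
    f x + f y + sum g∖xy                  ≡⟨ cong (f x + f y +_) (sum-cong-≗ g∖xy≗) ⟩
    f x + f y + sum (uncovered (e ∷ M) f) ∎
    where
    e = ((x , y) , xy)
    g = uncovered M f
    g∖xy = erase y (erase x g)
    g∖xy≗ : ∀ v → g∖xy v ≡ uncovered (e ∷ M) f v
    g∖xy≗ = erase-erase-uncovered e M f
    gx≡fx : g x ≡ f x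
    gx≡fx = uncovered-at M f (proj₁ (endpoints-uncovered xy M disjoint))
    gy≡fy : erase x g y ≡ f y
    gy≡fy = trans (erase-≢ g (λ { refl → irrefl G xy }))
                  (uncovered-at M f (proj₂ (endpoints-uncovered xy M disjoint)))

  sum-decompose : ∀ M → AllPairs (Disjoint {G = G}) M → ∀ f →
    sum f ≡ edgeSum M f + sum (uncovered M f)
  sum-decompose []                     []               f = refl
  sum-decompose (e@((_ , _) , xy) ∷ M) (e#M ∷ disjoint) f = begin
    sum f                             ≡⟨ sum-decompose M disjoint f ⟩
    edgeSum M f + sum (uncovered M f) ≡⟨ cong (edgeSum M f +_) (sum-uncovered-∷ xy M e#M f) ⟩
    edgeSum M f + (fe + rest)         ≡⟨ x∙yz≈y∙xz (edgeSum M f) fe rest ⟩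
    fe + (edgeSum M f + rest)         ≡⟨ sym (+-assoc fe (edgeSum M f) rest) ⟩
    edgeSum (e ∷ M) f + rest          ∎
    where
    fe = endpointSum f e
    rest = sum (uncovered (e ∷ M) f)

  vertex-count : ∀ M → AllPairs (Disjoint {G = G}) M → n ≡ length M * 2 + #uncovered M
  vertex-count M disjoint = begin
    n                                  ≡⟨ sym (trans (sum-const n 1) (*-identityʳ n)) ⟩
    sum {n} (λ _ → 1)                  ≡⟨ sum-decompose M disjoint (λ _ → 1) ⟩
    edgeSum M (λ _ → 1) + #uncovered M ≡⟨ cong (_+ #uncovered M) (sum-const (length M) 2) ⟩
    length M * 2 + #uncovered M        ∎

  matching-size≤ : (M : Matching G) → length (proj₁ M) ≤ n
  matching-size≤ (M , disjoint) = subst (length M ≤_) (sym (vertex-count M disjoint))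
    (≤-trans (m≤m*n (length M) 2) (m≤m+n _ _))

  ¬¬-∃IsMu : ¬ ¬ ∃ (IsMu G)
  ¬¬-∃IsMu k = ¬¬-maximum n (([] , []) , refl) (λ { (M , refl) → matching-size≤ M })
    λ { (m , sized , maximal) → k (m , sized , λ M → maximal (M , refl)) }

  α≡μ+#uncovered : ∀ {a} M → AllPairs (Disjoint {G = G}) M →
    a + length M ≡ n → a ≡ length M + #uncovered M
  α≡μ+#uncovered {a} M disjoint a+μ≡n = +-cancelʳ-≡ (length M) a _ (begin
    a + length M                       ≡⟨ trans a+μ≡n (vertex-count M disjoint) ⟩
    length M * 2 + #uncovered M        ≡⟨ m*2+n≡m+n+m (length M) (#uncovered M) ⟩
    length M + #uncovered M + length M ∎)

  independent⇒endpointSum≤1 : ∀ {T} → Independent G T → ∀ e → endpointSum (χ T) e ≤ 1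
  independent⇒endpointSum≤1 {T} independent ((x , y) , xy) with lookup T x in Tx | lookup T y in Ty
  ... | true  | true  = ⊥-elim (independent (lookup⇒[]= x T Tx) (lookup⇒[]= y T Ty) xy)
  ... | true  | false = ≤-refl
  ... | false | b     = 𝟙≤1 b

  MaxIndependent⇒∣∣≡α : ∀ {a T} → IsAlpha G a → MaxIndependent G T → ∣ T ∣ ≡ a
  MaxIndependent⇒∣∣≡α ((S , S-independent , ∣S∣≡a) , ≤a) (T-independent , ≤∣T∣) =
    ≤-antisym (≤a _ T-independent) (subst (_≤ _) ∣S∣≡a (≤∣T∣ S S-independent))

  record Straddles (M : List (Edge G)) (T : Subset n) : Set where
    field
      one-endpoint : ∀ i → let e = List.lookup M i in lookup T (end₂ e) ≡ not (lookup T (end₁ e))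
      uncovered∈   : ∀ v → covered M v ≡ false → lookup T v ≡ true

  -- Decomposing |T| by sum-decompose, every edge term is ≤ 1 and every vertex term is ≤ 1;
  -- the size |M| + #uncovered M forces equality in each of them.
  straddles : ∀ M → AllPairs (Disjoint {G = G}) M → ∀ T → Independent G T →
    ∣ T ∣ ≡ length M + #uncovered M → Straddles M T
  straddles M disjoint T independent ∣T∣≡ = record
    { one-endpoint = λ i → 𝟙+𝟙≡1⇒≡not _ _ (sum-tight edges≤ (≤-reflexive (sym (proj₁ tight))) i)
    ; uncovered∈   = λ v cv → 𝟙≡1⇒≡true (begin
        χ T v                   ≡⟨ sym (uncovered-at M (χ T) cv) ⟩
        uncovered M (χ T) v     ≡⟨ sum-tight uncovered≤ (≤-reflexive (sym (proj₂ tight))) v ⟩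
        uncovered M (λ _ → 1) v ≡⟨ uncovered-at M _ cv ⟩
        1                       ∎)
    }
    where
    edges≤ : ∀ i → endpointSum (χ T) (List.lookup M i) ≤ 1
    edges≤ i = independent⇒endpointSum≤1 independent (List.lookup M i)
    uncovered≤ : ∀ v → uncovered M (χ T) v ≤ uncovered M (λ _ → 1) v
    uncovered≤ = uncovered-mono-≤ M (𝟙≤1 ∘ lookup T)
    μ≡ : sum {length M} (λ _ → 1) ≡ length M
    μ≡ = trans (sum-const (length M) 1) (*-identityʳ _)
    tight : edgeSum M (χ T) ≡ sum {length M} (λ _ → 1) × sum (uncovered M (χ T)) ≡ #uncovered M
    tight = +-tight (sum-mono-≤ edges≤) (sum-mono-≤ uncovered≤) (≤-reflexive (begin
      sum {length M} (λ _ → 1) + #uncovered M    ≡⟨ cong (_+ #uncovered M) μ≡ ⟩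
      length M + #uncovered M                    ≡⟨ sym ∣T∣≡ ⟩
      ∣ T ∣                                      ≡⟨ ∣p∣≡∑χp T ⟩
      sum (χ T)                                  ≡⟨ sum-decompose M disjoint (χ T) ⟩
      edgeSum M (χ T) + sum (uncovered M (χ T))  ∎))

  ∣⋃∣+∣⋂∣≡2[μ+#uncovered] : ∀ M → AllPairs (Disjoint {G = G}) M →
    ∀ S Γ → All (Straddles M) (S ∷ Γ) →
    ∣ ⋃ (S ∷ Γ) ∣ + ∣ ⋂ (S ∷ Γ) ∣ ≡ 2 * (length M + #uncovered M)
  ∣⋃∣+∣⋂∣≡2[μ+#uncovered] M disjoint S Γ straddle = begin
    ∣ ⋃ L ∣ + ∣ ⋂ L ∣                            ≡⟨ cong₂ _+_ (∣p∣≡∑χp (⋃ L)) (∣p∣≡∑χp (⋂ L)) ⟩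
    sum (χ (⋃ L)) + sum (χ (⋂ L))                ≡⟨ sym (∑-distrib-+ (χ (⋃ L)) (χ (⋂ L))) ⟩
    sum f                                        ≡⟨ sum-decompose M disjoint f ⟩
    edgeSum M f + sum (uncovered M f)            ≡⟨ cong₂ _+_ edges vertices ⟩
    length M * 2 + (#uncovered M + #uncovered M) ≡⟨ m*2+[n+n]≡2*[m+n] (length M) (#uncovered M) ⟩
    2 * (length M + #uncovered M)                ∎
    where
    L = S ∷ Γ
    f : Vector ℕ n
    f v = χ (⋃ L) v + χ (⋂ L) v
    f≡ : ∀ v → f v ≡ 𝟙 (any (λ T → lookup T v) L) + 𝟙 (all (λ T → lookup T v) L)
    f≡ v = cong₂ (λ b c → 𝟙 b + 𝟙 c) (lookup-⋃ L v) (lookup-⋂ L v)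

    edge≡2 : ∀ i → endpointSum f (List.lookup M i) ≡ 2
    edge≡2 i = begin
      f x + f y                                          ≡⟨ cong₂ _+_ (f≡ x) (f≡ y) ⟩
      (𝟙 (any p L) + 𝟙 (all p L)) + (𝟙 (any q L) + 𝟙 (all q L))
        ≡⟨ cong₂ (λ b c → (𝟙 (any p L) + 𝟙 (all p L)) + (𝟙 b + 𝟙 c))
                 (any-complement L q≡not-p) (all-complement L q≡not-p) ⟩
      (𝟙 (any p L) + 𝟙 (all p L)) + (𝟙 (not (all p L)) + 𝟙 (not (any p L)))
        ≡⟨ 𝟙-complements (any p L) (all p L) ⟩
      2                                                  ∎
      where
      x = end₁ (List.lookup M i)
      y = end₂ (List.lookup M i)
      p q : Subset n → Bool
      p T = lookup T x
      q T = lookup T y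
      q≡not-p : All (λ T → q T ≡ not (p T)) L
      q≡not-p = All.map (λ s → Straddles.one-endpoint s i) straddle

    vertex≡2 : ∀ v → uncovered M f v ≡ uncovered M (λ _ → 1) v + uncovered M (λ _ → 1) v
    vertex≡2 v with covered M v in cv
    ... | true  = refl
    ... | false = begin
      f v                                                          ≡⟨ f≡ v ⟩
      𝟙 (any (λ T → lookup T v) L) + 𝟙 (all (λ T → lookup T v) L)
        ≡⟨ cong₂ (λ b c → 𝟙 b + 𝟙 c) (any-true v∈all) (all-true L v∈all) ⟩
      2                                                            ∎
      where
      v∈all : All (λ T → lookup T v ≡ true) L
      v∈all = All.map (λ s → Straddles.uncovered∈ s v cv) straddle

    edges : edgeSum M f ≡ length M * 2
    edges = trans (sum-cong-≗ edge≡2) (sum-const (length M) 2)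
    vertices : sum (uncovered M f) ≡ #uncovered M + #uncovered M
    vertices = trans (sum-cong-≗ vertex≡2) (∑-distrib-+ (uncovered M (λ _ → 1)) _)

mainTheorem2 : ∀ {n} (G : Graph n) → KönigEgerváry G → ∀ a → IsAlpha G a →
    ∀ (S : Subset n) (Γ : List (Subset n)) → All (MaxIndependent G) (S ∷ Γ) →
      ∣ ⋃ (S ∷ Γ) ∣ + ∣ ⋂ (S ∷ Γ) ∣ ≡ 2 * a
mainTheorem2 {n} G könig-egerváry a isα S Γ maximum =
  decidable-stable (_ ≟ℕ _) λ ≢ → ¬¬-∃IsMu G λ (m , isμ) →
    ≢ (given-maximum-matching isμ (könig-egerváry a m isα isμ))
  where
  given-maximum-matching : ∀ {m} → IsMu G m → a + m ≡ n →
    ∣ ⋃ (S ∷ Γ) ∣ + ∣ ⋂ (S ∷ Γ) ∣ ≡ 2 * a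
  given-maximum-matching (((M , disjoint) , refl) , _) a+μ≡n = begin
    ∣ ⋃ (S ∷ Γ) ∣ + ∣ ⋂ (S ∷ Γ) ∣   ≡⟨ ∣⋃∣+∣⋂∣≡2[μ+#uncovered] G M disjoint S Γ
                                        (All.map straddles-M maximum) ⟩
    2 * (length M + #uncovered G M) ≡⟨ cong (2 *_) (sym a≡μ+c) ⟩
    2 * a                           ∎
    where
    a≡μ+c : a ≡ length M + #uncovered G M
    a≡μ+c = α≡μ+#uncovered G M disjoint a+μ≡n
    straddles-M : ∀ {T} → MaxIndependent G T → Straddles G M T
    straddles-M max@(independent , _) =
      straddles G M disjoint _ independent (trans (MaxIndependent⇒∣∣≡α G isα max) a≡μ+c)
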